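{- Let $\ell,m$ be positive integers and $\mu\in\mathcal{P}^{\ell,m+\ell-1}$, and let $\mu'=\tau_{\ell+m-1}(\mu)$. Then $\tilde\mu$ satisfies "for every $i\in[\ell]$, $\tilde\mu(i)<i$ implies $\tilde\mu(\tilde\mu(i))<i$" if and only if $\widetilde{\mu'}$ satisfies "for every $i\in[\ell]$, $\widetilde{\mu'}(i)>i$ implies $\widetilde{\mu'}(\widetilde{\mu'}(i))>i$".
   Context: $[n]=\{1,\dots,n\}$. A partition with $n$ parts is a weakly decreasing sequence of $n$ positive integers, identified with the function $[n]\to\mathbb{Z}^+$, $i\mapsto\mu_i=\mu(i)$. $\mathcal{P}^{n,k}$ is the set of partitions with exactly $n$ parts all at most $k$. $\tau_k(\lambda_1,\dots,\lambda_n)=(k+1-\lambda_n,\dots,k+1-\lambda_1)$. Let $t:[\ell]\times[\ell+m-1]\to[\ell]$ be $t(r,s)=s$ if $s<r$, $t(r,s)=r$ if $r\leq s\leq m+r-1$, $t(r,s)=s-m+1$ if $s>m+r-1$; for $\nu\in\mathcal{P}^{\ell,\ell+m-1}$, $\tilde\nu:[\ell]\to[\ell]$ is $\tilde\nu(i)=t(i,\nu(i))$. -}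

module Defs where

open import Data.Nat using (ℕ; suc; _+_; _∸_; _≤_; _<_; _≤?_; _<?_)
open import Data.Product using (_×_)
open import Relation.Nullary using (yes; no)

-- Sequences are indexed 1-based: a partition with n parts is a function
-- μ : ℕ → ℕ of which only the values μ 1, …, μ n matter.

IsPartition : ℕ → ℕ → (ℕ → ℕ) → Set
IsPartition n k μ =
  (∀ i → 1 ≤ i → i ≤ n → (1 ≤ μ i) × (μ i ≤ k)) ×
  (∀ i j → 1 ≤ i → i ≤ j → j ≤ n → μ j ≤ μ i)

τ : ℕ → ℕ → (ℕ → ℕ) → (ℕ → ℕ)
τ n k μ i = suc k ∸ μ (suc n ∸ i)

t : ℕ → ℕ → ℕ → ℕ
t m r s with s <? r
... | yes _ = s
... | no _ with s ≤? m + r ∸ 1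
...   | yes _ = r
...   | no _ = s + 1 ∸ m

tilde : ℕ → (ℕ → ℕ) → (ℕ → ℕ)
tilde m ν i = t m i (ν i)

LowCond : ℕ → (ℕ → ℕ) → Set
LowCond ℓ f = ∀ i → 1 ≤ i → i ≤ ℓ → f i < i → f (f i) < i

HighCond : ℕ → (ℕ → ℕ) → Set
HighCond ℓ f = ∀ i → 1 ≤ i → i ≤ ℓ → i < f i → i < f (f i)

module Submission where

-- The proof is a symmetry argument.
--
-- 1. Write m = b + 1 and N = ℓ + 1.  The map t(r, s) is invariant under the
--    reflection (r, s) ↦ (N - r, N + b - s) of its domain, up to the
--    reflection v ↦ N - v of its values (t-reflect).  Since τ reflects both
--    the index and the value of a part, this gives μ̃' = ρ ∘ μ̃ ∘ ρ on [ℓ],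
--    where ρ(i) = ℓ + 1 - i is the mirror image of [ℓ].
-- 2. ρ is an order-reversing involution of [ℓ]; so for any f : [ℓ] → [ℓ],
--    conjugating by ρ turns "f(j) < j ⇒ f(f(j)) < j" at j = ρ(i) into
--    "i < g(i) ⇒ i < g(g(i))" for g = ρ ∘ f ∘ ρ (conjugate-LowCond⇔HighCond).
-- 3. t maps [ℓ] × [ℓ + b] into [ℓ] (t-range), so μ̃ is a map [ℓ] → [ℓ] and
--    step 2 applies to f = μ̃, g = μ̃'.
-- Only the bounds 1 ≤ μ(i) ≤ ℓ + m - 1 are used, not monotonicity.

open import Defs
open import Data.Nat using (ℕ; zero; suc; _+_; _∸_; _≤_; _<_; _≤?_; _<?_; s≤s)
open import Data.Nat.Properties
open import Data.Product using (_×_; _,_; proj₁; proj₂)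
open import Data.Empty using (⊥-elim)
open import Function.Bundles using (_⇔_; mk⇔; Equivalence)
open import Relation.Nullary using (yes; no)
open import Relation.Binary.PropositionalEquality
open import Algebra.Properties.CommutativeSemigroup +-commutativeSemigroup
  using (x∙yz≈xz∙y; xy∙z≈yz∙x; xy∙z≈xz∙y)

MapsInto : ℕ → (ℕ → ℕ) → Set
MapsInto ℓ f = ∀ i → 1 ≤ i → i ≤ ℓ → (1 ≤ f i) × (f i ≤ ℓ)

mirror : ℕ → ℕ → ℕ
mirror ℓ i = suc ℓ ∸ i

mirror-range : ∀ ℓ i → 1 ≤ i → i ≤ ℓ → (1 ≤ mirror ℓ i) × (mirror ℓ i ≤ ℓ)
mirror-range ℓ i 1≤i i≤ℓ = m<n⇒0<n∸m (s≤s i≤ℓ) , ∸-monoʳ-≤ (suc ℓ) 1≤i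

mirror-involutive : ∀ ℓ i → i ≤ ℓ → mirror ℓ (mirror ℓ i) ≡ i
mirror-involutive ℓ i i≤ℓ = m∸[m∸n]≡n (m≤n⇒m≤1+n i≤ℓ)

-- ρ reverses the order: x < N - y iff x + y < N iff y < N - x.
<-∸-swap : ∀ N x y → x < N ∸ y → y < N ∸ x
<-∸-swap N x y x<N∸y =
  m+n≤o⇒m≤o∸n (suc y) (subst (_≤ N) (cong suc (+-comm x y)) x+y<N)
  where
  y≤N : y ≤ N
  y≤N = <⇒≤ (m∸n≢0⇒n<m (λ N∸y≡0 → n≮0 (subst (x <_) N∸y≡0 x<N∸y)))
  x+y<N : x + y < N
  x+y<N = m≤o∸n⇒m+n≤o (suc x) y≤N x<N∸y

MirrorConjugate : ℕ → (ℕ → ℕ) → (ℕ → ℕ) → Set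
MirrorConjugate ℓ f g = ∀ i → 1 ≤ i → i ≤ ℓ → g i ≡ mirror ℓ (f (mirror ℓ i))

conjugate-step : ∀ ℓ f g → MapsInto ℓ f → MirrorConjugate ℓ f g →
  ∀ i → 1 ≤ i → i ≤ ℓ →
  let j = mirror ℓ i in (f j < j → f (f j) < j) ⇔ (i < g i → i < g (g i))
conjugate-step ℓ f g f-maps g≡ i 1≤i i≤ℓ = mk⇔ low⇒high high⇒low
  where
  N : ℕ
  N = suc ℓ
  j : ℕ
  j = mirror ℓ i
  j-range : (1 ≤ j) × (j ≤ ℓ)
  j-range = mirror-range ℓ i 1≤i i≤ℓ
  fj-range : (1 ≤ f j) × (f j ≤ ℓ)
  fj-range = f-maps j (proj₁ j-range) (proj₂ j-range)

  gi : g i ≡ N ∸ f j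
  gi = g≡ i 1≤i i≤ℓ

  ggi : g (g i) ≡ N ∸ f (f j)
  ggi = begin
    g (g i)                       ≡⟨ cong g gi ⟩
    g (mirror ℓ (f j))            ≡⟨ g≡ _ (proj₁ gfj-range) (proj₂ gfj-range) ⟩
    N ∸ f (mirror ℓ (mirror ℓ (f j))) ≡⟨ cong (λ k → N ∸ f k) (mirror-involutive ℓ (f j) (proj₂ fj-range)) ⟩
    N ∸ f (f j)                   ∎
    where
    open ≡-Reasoning
    gfj-range : (1 ≤ mirror ℓ (f j)) × (mirror ℓ (f j) ≤ ℓ)
    gfj-range = mirror-range ℓ (f j) (proj₁ fj-range) (proj₂ fj-range)

  low⇒high : (f j < j → f (f j) < j) → i < g i → i < g (g i)
  low⇒high low i<gi =
    subst (i <_) (sym ggi) (<-∸-swap N _ i (low (<-∸-swap N i _ (subst (i <_) gi i<gi))))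

  high⇒low : (i < g i → i < g (g i)) → f j < j → f (f j) < j
  high⇒low high fj<j =
    <-∸-swap N i _ (subst (i <_) ggi (high (subst (i <_) (sym gi) (<-∸-swap N _ i fj<j))))

conjugate-LowCond⇔HighCond : ∀ ℓ f g → MapsInto ℓ f → MirrorConjugate ℓ f g →
  LowCond ℓ f ⇔ HighCond ℓ g
conjugate-LowCond⇔HighCond ℓ f g f-maps g≡ = mk⇔ low⇒high high⇒low
  where
  step : ∀ i → 1 ≤ i → i ≤ ℓ → let j = mirror ℓ i in
    (f j < j → f (f j) < j) ⇔ (i < g i → i < g (g i))
  step = conjugate-step ℓ f g f-maps g≡

  low⇒high : LowCond ℓ f → HighCond ℓ g
  low⇒high low i 1≤i i≤ℓ =
    Equivalence.to (step i 1≤i i≤ℓ) (low _ (proj₁ j-range) (proj₂ j-range))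
    where
    j-range : (1 ≤ mirror ℓ i) × (mirror ℓ i ≤ ℓ)
    j-range = mirror-range ℓ i 1≤i i≤ℓ

  high⇒low : HighCond ℓ g → LowCond ℓ f
  high⇒low high j 1≤j j≤ℓ =
    subst (λ k → f k < k → f (f k) < k) (mirror-involutive ℓ j j≤ℓ)
      (Equivalence.from (step i (proj₁ i-range) (proj₂ i-range))
        (high i (proj₁ i-range) (proj₂ i-range)))
    where
    i : ℕ
    i = mirror ℓ j
    i-range : (1 ≤ i) × (i ≤ ℓ)
    i-range = mirror-range ℓ j 1≤j j≤ℓ

data TView (b r s : ℕ) : ℕ → Set where
  below  : s < r → TView b r s s
  middle : r ≤ s → s ≤ b + r → TView b r s r
  above  : ∀ {v} → b + r < s → v + b ≡ s → TView b r s v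

-- In the last case t(r, s) = s + 1 - m, and (s + 1 - (b + 1)) + b = s.
t-view : ∀ b r s → TView b r s (t (suc b) r s)
t-view b r s with s <? r
... | yes s<r = below s<r
... | no s≮r with s ≤? b + r
...   | yes s≤b+r = middle (≮⇒≥ s≮r) s≤b+r
...   | no s≰b+r = above b+r<s (trans (cong (λ x → (x ∸ suc b) + b) (+-comm s 1)) (m∸n+n≡m b≤s))
  where
  b+r<s : b + r < s
  b+r<s = ≰⇒> s≰b+r
  b≤s : b ≤ s
  b≤s = ≤-trans (m≤m+n b r) (<⇒≤ b+r<s)

TView-unique : ∀ {b r s v w} → TView b r s v → TView b r s w → v ≡ w
TView-unique (below _)       (below _)        = refl
TView-unique (below s<r)     (middle r≤s _)   = ⊥-elim (<⇒≱ s<r r≤s)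
TView-unique (below s<r)     (above b+r<s _)  = ⊥-elim (<⇒≱ s<r (≤-trans (m≤n+m _ _) (<⇒≤ b+r<s)))
TView-unique (middle r≤s _)  (below s<r)      = ⊥-elim (<⇒≱ s<r r≤s)
TView-unique (middle _ _)    (middle _ _)     = refl
TView-unique (middle _ s≤b+r) (above b+r<s _) = ⊥-elim (<⇒≱ b+r<s s≤b+r)
TView-unique (above b+r<s _) (below s<r)      = ⊥-elim (<⇒≱ s<r (≤-trans (m≤n+m _ _) (<⇒≤ b+r<s)))
TView-unique (above b+r<s _) (middle _ s≤b+r) = ⊥-elim (<⇒≱ b+r<s s≤b+r)
TView-unique {b} (above _ v+b≡s) (above _ w+b≡s) = +-cancelʳ-≡ b _ _ (trans v+b≡s (sym w+b≡s))

t-value : ∀ {b r s v} → TView b r s v → t (suc b) r s ≡ v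
t-value {b} {r} {s} = TView-unique (t-view b r s)

-- Reflecting (r, s) ↦ (N - r, N + b - s) with N = r + r' reflects the value:
-- the cases "below" and "above" are exchanged, "middle" is preserved.
TView-reflect : ∀ {b r r' s s' v} → s + s' ≡ (r + r') + b →
  TView b r s v → TView b r' s' ((r + r') ∸ v)
TView-reflect {b} {r} {r'} {s} {s'} sum (below s<r) = above b+r'<s' value
  where
  open ≤-Reasoning
  s≤N : s ≤ r + r'
  s≤N = ≤-trans (<⇒≤ s<r) (m≤m+n r r')
  b+r'<s' : b + r' < s'
  b+r'<s' = +-cancelˡ-< s _ _ (begin-strict
    s + (b + r')   <⟨ +-monoˡ-< (b + r') s<r ⟩
    r + (b + r')   ≡⟨ x∙yz≈xz∙y r b r' ⟩
    (r + r') + b   ≡⟨ sum ⟨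
    s + s'         ∎)
  value : ((r + r') ∸ s) + b ≡ s'
  value = +-cancelˡ-≡ s _ _ (begin-equality
    s + ((r + r' ∸ s) + b) ≡⟨ +-assoc s _ b ⟨
    (s + (r + r' ∸ s)) + b ≡⟨ cong (_+ b) (m+[n∸m]≡n s≤N) ⟩
    (r + r') + b           ≡⟨ sum ⟨
    s + s'                 ∎)
TView-reflect {b} {r} {r'} {s} {s'} sum (middle r≤s s≤b+r) =
  subst (TView b r' s') (sym (m+n∸m≡n r r')) (middle r'≤s' s'≤b+r')
  where
  open ≤-Reasoning
  r'≤s' : r' ≤ s'
  r'≤s' = +-cancelˡ-≤ s _ _ (begin
    s + r'         ≤⟨ +-monoˡ-≤ r' s≤b+r ⟩
    (b + r) + r'   ≡⟨ xy∙z≈yz∙x b r r' ⟩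
    (r + r') + b   ≡⟨ sum ⟨
    s + s'         ∎)
  s'≤b+r' : s' ≤ b + r'
  s'≤b+r' = +-cancelˡ-≤ r _ _ (begin
    r + s'         ≤⟨ +-monoˡ-≤ s' r≤s ⟩
    s + s'         ≡⟨ sum ⟩
    (r + r') + b   ≡⟨ x∙yz≈xz∙y r b r' ⟨
    r + (b + r')   ∎)
TView-reflect {b} {r} {r'} {s} {s'} {v} sum (above b+r<s v+b≡s) =
  subst (TView b r' s') s'≡N∸v (below s'<r')
  where
  open ≤-Reasoning
  s'<r' : s' < r'
  s'<r' = +-cancelˡ-< (b + r) _ _ (begin-strict
    (b + r) + s'   <⟨ +-monoˡ-< s' b+r<s ⟩
    s + s'         ≡⟨ sum ⟩
    (r + r') + b   ≡⟨ xy∙z≈yz∙x b r r' ⟨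
    (b + r) + r'   ∎)
  v+s'≡N : v + s' ≡ r + r'
  v+s'≡N = +-cancelʳ-≡ b _ _ (begin-equality
    (v + s') + b   ≡⟨ xy∙z≈xz∙y v s' b ⟩
    (v + b) + s'   ≡⟨ cong (_+ s') v+b≡s ⟩
    s + s'         ≡⟨ sum ⟩
    (r + r') + b   ∎)
  s'≡N∸v : s' ≡ (r + r') ∸ v
  s'≡N∸v = trans (sym (m+n∸m≡n v s')) (cong (_∸ v) v+s'≡N)

t-reflect : ∀ b N r r' s s' → r + r' ≡ N → s + s' ≡ N + b →
  t (suc b) r' s' ≡ N ∸ t (suc b) r s
t-reflect b .(r + r') r r' s s' refl sum =
  t-value (TView-reflect sum (t-view b r s))

t-range : ∀ ℓ b r s → 1 ≤ r → r ≤ ℓ → 1 ≤ s → s ≤ ℓ + b →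
  (1 ≤ t (suc b) r s) × (t (suc b) r s ≤ ℓ)
t-range ℓ b r s 1≤r r≤ℓ 1≤s s≤ℓ+b = range (t-view b r s)
  where
  range : ∀ {v} → TView b r s v → (1 ≤ v) × (v ≤ ℓ)
  range (below s<r)     = 1≤s , ≤-trans (<⇒≤ s<r) r≤ℓ
  range (middle _ _)    = 1≤r , r≤ℓ
  range {v} (above b+r<s v+b≡s) =
    ≤-trans 1≤r (<⇒≤ (+-cancelˡ-< b r v (subst (b + r <_) (trans (sym v+b≡s) (+-comm v b)) b+r<s))) ,
    +-cancelʳ-≤ b v ℓ (subst (_≤ ℓ + b) (sym v+b≡s) s≤ℓ+b)

mainTheorem5 : (ℓ m : ℕ) → 1 ≤ ℓ → 1 ≤ m → (μ : ℕ → ℕ) →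
    IsPartition ℓ (ℓ + m ∸ 1) μ →
    (LowCond ℓ (tilde m μ) ⇔ HighCond ℓ (tilde m (τ ℓ (ℓ + m ∸ 1) μ)))
mainTheorem5 ℓ zero _ () μ _
mainTheorem5 zero (suc b) () _ μ _
mainTheorem5 ℓ@(suc a) (suc b) _ _ μ (bounds , _) =
  conjugate-LowCond⇔HighCond ℓ (tilde (suc b) μ) (tilde (suc b) μ') μ̃-maps μ̃'-conjugate
  where
  K : ℕ
  K = a + suc b
  K≡ℓ+b : K ≡ ℓ + b
  K≡ℓ+b = +-suc a b
  μ' : ℕ → ℕ
  μ' = τ ℓ K μ

  μ̃-maps : MapsInto ℓ (tilde (suc b) μ)
  μ̃-maps i 1≤i i≤ℓ = t-range ℓ b i (μ i) 1≤i i≤ℓ (proj₁ (bounds i 1≤i i≤ℓ))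
    (subst (μ i ≤_) K≡ℓ+b (proj₂ (bounds i 1≤i i≤ℓ)))

  -- μ̃'(i) = t(i, K + 1 - μ(ρ i)) is the reflection of μ̃(ρ i) = t(ρ i, μ(ρ i)).
  μ̃'-conjugate : MirrorConjugate ℓ (tilde (suc b) μ) (tilde (suc b) μ')
  μ̃'-conjugate i 1≤i i≤ℓ =
    t-reflect b (suc ℓ) (mirror ℓ i) i (μ j) (suc K ∸ μ j)
      (m∸n+n≡m (m≤n⇒m≤1+n i≤ℓ))
      (trans (m+[n∸m]≡n (m≤n⇒m≤1+n μj≤K)) (cong suc K≡ℓ+b))
    where
    j : ℕ
    j = mirror ℓ i
    j-range : (1 ≤ j) × (j ≤ ℓ)
    j-range = mirror-range ℓ i 1≤i i≤ℓ
    μj≤K : μ j ≤ K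
    μj≤K = proj₂ (bounds j (proj₁ j-range) (proj₂ j-range))
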